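{- Let $T$ be an $r$-uniform tight tree with $\ell$ edges, and let $G$ be an $r$-graph on $[n]$ not containing a copy of $T$. Then $|G|\le (\ell-1)|\partial G|$.
   Context: An $r$-graph is a family of $r$-subsets of a finite set. A hypergraph with edges $e_1,\dots,e_\ell$ is a forest if the edges can be ordered so that for every $1<i\le\ell$ there is $1\le i'<i$ with $e_i\cap\bigcup_{j<i}e_j\subseteq e_{i'}$; a connected forest is a tree. An $r$-uniform tree is tight if, in such an ordering, $|e_i\cap\bigcup_{j<i}e_j|=r-1$ for each $i>1$. The shadow $\partial G$ of an $r$-graph $G$ is the family of $(r-1)$-sets contained in some edge of $G$. -}

module Defs where

open import Data.Nat using (ℕ; zero; suc; _∸_; _<_)
open import Data.Fin using (Fin; toℕ)
open import Data.Fin.Subset using (Subset; ∣_∣; _⊆_; _∩_; _∪_; ⊥; _∈_; Nonempty)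
open import Data.Fin.Subset.Properties using (_⊆?_)
open import Data.List using (List; []; _∷_; map; _++_; length; lookup; take; foldr; filter)
open import Data.List.Relation.Unary.All using (All)
open import Data.List.Relation.Unary.Any using (Any; any?)
open import Data.List.Relation.Unary.Unique.Propositional using (Unique)
open import Data.List.Relation.Binary.Permutation.Propositional using (_↭_)
open import Data.List.Membership.Propositional using () renaming (_∈_ to _∈ₗ_)
open import Data.Vec using (_∷_; [])
open import Data.Product using (Σ; ∃; ∃-syntax; _×_)
open import Data.Nat using (_≟_)
open import Relation.Nullary using (Dec; _×-dec_)
open import Relation.Binary.PropositionalEquality using (_≡_)
open import Relation.Binary.Construct.Closure.ReflexiveTransitive using (Star)
open import Function.Definitions using (Injective)
open import Function.Bundles using (_⇔_)

-- An r-graph on the vertex set Fin n (i.e. [n]): a duplicate-free list of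
-- subsets of Fin n, each of size r.  |G| is then the length of the list.
record RGraph (r n : ℕ) : Set where
  field
    edges   : List (Subset n)
    unique  : Unique edges
    uniform : All (λ e → ∣ e ∣ ≡ r) edges
open RGraph public

allSubsets : (n : ℕ) → List (Subset n)
allSubsets zero    = [] ∷ []
allSubsets (suc n) = map (Data.Bool.true ∷_) (allSubsets n) ++ map (Data.Bool.false ∷_) (allSubsets n)
  where import Data.Bool

InShadow : ∀ {n} (r : ℕ) → List (Subset n) → Subset n → Set
InShadow r es s = (∣ s ∣ ≡ r ∸ 1) × Any (λ e → s ⊆ e) es

inShadow? : ∀ {n} (r : ℕ) (es : List (Subset n)) (s : Subset n) → Dec (InShadow r es s)
inShadow? r es s = (∣ s ∣ ≟ r ∸ 1) ×-dec any? (λ e → s ⊆? e) es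

shadow : ∀ {r n} → RGraph r n → List (Subset n)
shadow {r} {n} G = filter (inShadow? r (edges G)) (allSubsets n)

∣∂_∣ : ∀ {r n} → RGraph r n → ℕ
∣∂ G ∣ = length (shadow G)

prefixUnion : ∀ {m} (es : List (Subset m)) → ℕ → Subset m
prefixUnion es i = foldr _∪_ ⊥ (take i es)

ForestOrdering : ∀ {m} → List (Subset m) → Set
ForestOrdering es =
  (i : Fin (length es)) → 0 < toℕ i →
  ∃[ i' ] (toℕ i' < toℕ i × (lookup es i ∩ prefixUnion es (toℕ i)) ⊆ lookup es i')

TightOrdering : ∀ {m} (r : ℕ) → List (Subset m) → Set
TightOrdering r es =
  ForestOrdering es ×
  ((i : Fin (length es)) → 0 < toℕ i → ∣ lookup es i ∩ prefixUnion es (toℕ i) ∣ ≡ r ∸ 1)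

Meets : ∀ {m} (es : List (Subset m)) → Fin (length es) → Fin (length es) → Set
Meets es i j = Nonempty (lookup es i ∩ lookup es j)

Connected : ∀ {m} → List (Subset m) → Set
Connected es = (i j : Fin (length es)) → Star (Meets es) i j

-- T (an r-graph on its vertex set Fin m) is an r-uniform tight tree with ℓ
-- edges.  The vertex set of T is the union of its edges (every vertex covered).
record TightTree (r ℓ : ℕ) : Set where
  field
    m        : ℕ
    graph    : RGraph r m
    size     : length (edges graph) ≡ ℓ
    covering : (v : Fin m) → Any (λ e → v ∈ e) (edges graph)
    connected : Connected (edges graph)
    ordering : ∃[ es ] (edges graph ↭ es × TightOrdering r es)
open TightTree public

ContainsCopy : ∀ {r ℓ n} → RGraph r n → TightTree r ℓ → Set
ContainsCopy {n = n} G T =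
  Σ (Fin (m T) → Fin n) λ φ →
    Injective _≡_ _≡_ φ ×
    All (λ e → ∃[ g ] (g ∈ₗ edges G × ((x : Fin n) → x ∈ g ⇔ (∃[ v ] (v ∈ e × φ v ≡ x)))))
        (edges (graph T))

-- The proof is by well-founded induction on |∂G|.
--  * If some (r-1)-set S of the shadow lies in at most ℓ - 1 edges, delete
--    those edges.  The result G' is still T-free and S ∉ ∂G' ⊆ ∂G, so by
--    induction |G| = codeg(S) + |G'| ≤ (ℓ-1) + (ℓ-1)|∂G'| ≤ (ℓ-1)|∂G|.
--  * Otherwise every shadow set has codegree ≥ ℓ, and then a nonempty G
--    contains T: embed the edges of T greedily along a tight ordering.  When
--    the k-th edge e is added, I = e ∩ (earlier edges) is an (r-1)-set lying
--    in an earlier edge, so φ(I) belongs to ∂G.  Of the ≥ ℓ > k edges through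
--    φ(I), at most |φ(P) ∖ φ(I)| ≤ k lie inside the current image φ(P), so
--    some edge meets φ(P) exactly in φ(I), and e can be mapped onto it.
module Submission where

open import Defs
open import Data.Nat using (ℕ; _≤_; _*_; _∸_)
open import Data.List using (length)
open import Relation.Nullary using (¬_)

open import Data.Nat using (zero; suc; _+_; _<_; _≟_; _≤?_; z≤n; s≤s)
open import Data.Nat.Properties
open import Data.Nat.Induction using (<-wellFounded)
open import Induction.WellFounded using (Acc; acc)
open import Data.Bool using (true; false)
open import Data.Fin using (Fin; zero; suc; toℕ; fromℕ<)
open import Data.Fin.Properties using (toℕ<n; toℕ-fromℕ<) renaming (any? to anyFin?)
open import Data.Fin.Subset
open import Data.Fin.Subset.Properties
open import Data.Vec using ([]; _∷_; here; there)
open import Data.List using (List; []; _∷_; _++_; filter; take; lookup)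
open import Data.List.Properties using (filter-accept; filter-reject; filter-notAll; take-suc; take-all)
open import Data.List.Relation.Unary.All as All using (All; []; _∷_)
import Data.List.Relation.Unary.All.Properties as AllP
open import Data.List.Relation.Unary.Any using (Any; here; there; any?)
open import Data.List.Relation.Unary.AllPairs using ([]; _∷_)
open import Data.List.Relation.Unary.Unique.Propositional using (Unique)
import Data.List.Relation.Unary.Unique.Propositional.Properties as UniqueP
open import Data.List.Membership.Propositional using (find; lose) renaming (_∈_ to _∈ₗ_)
open import Data.List.Membership.Propositional.Properties using (∈-filter⁺; ∈-filter⁻; ∈-lookup; ∈-++⁺ˡ; ∈-++⁺ʳ; ∈-map⁺)
open import Data.List.Relation.Binary.Permutation.Propositional using (_↭_; ↭-sym)
open import Data.List.Relation.Binary.Permutation.Propositional.Properties using (All-resp-↭; Any-resp-↭; ↭-length)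
open import Data.Product using (∃-syntax; _×_; _,_; proj₁; proj₂)
open import Data.Sum using (inj₁; inj₂)
open import Data.Empty using (⊥-elim)
open import Function using (_∘_)
open import Function.Bundles using (mk⇔)
open import Relation.Nullary using (yes; no; ¬?; contradiction; _×-dec_)
open import Relation.Unary using (Decidable)
open import Relation.Binary.PropositionalEquality

∣p∣≡∣p∩q∣+∣p─q∣ : ∀ {n} (p q : Subset n) → ∣ p ∣ ≡ ∣ p ∩ q ∣ + ∣ p ─ q ∣
∣p∣≡∣p∩q∣+∣p─q∣ []          []          = refl
∣p∣≡∣p∩q∣+∣p─q∣ (true ∷ p)  (true ∷ q)  = cong suc (∣p∣≡∣p∩q∣+∣p─q∣ p q)
∣p∣≡∣p∩q∣+∣p─q∣ (true ∷ p)  (false ∷ q) = trans (cong suc (∣p∣≡∣p∩q∣+∣p─q∣ p q)) (sym (+-suc _ _))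
∣p∣≡∣p∩q∣+∣p─q∣ (false ∷ p) (true ∷ q)  = ∣p∣≡∣p∩q∣+∣p─q∣ p q
∣p∣≡∣p∩q∣+∣p─q∣ (false ∷ p) (false ∷ q) = ∣p∣≡∣p∩q∣+∣p─q∣ p q

∣p∪q∣≡∣p∣+∣q─p∣ : ∀ {n} (p q : Subset n) → ∣ p ∪ q ∣ ≡ ∣ p ∣ + ∣ q ─ p ∣
∣p∪q∣≡∣p∣+∣q─p∣ []          []          = refl
∣p∪q∣≡∣p∣+∣q─p∣ (true ∷ p)  (true ∷ q)  = cong suc (∣p∪q∣≡∣p∣+∣q─p∣ p q)
∣p∪q∣≡∣p∣+∣q─p∣ (true ∷ p)  (false ∷ q) = cong suc (∣p∪q∣≡∣p∣+∣q─p∣ p q)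
∣p∪q∣≡∣p∣+∣q─p∣ (false ∷ p) (true ∷ q)  = trans (cong suc (∣p∪q∣≡∣p∣+∣q─p∣ p q)) (sym (+-suc _ _))
∣p∪q∣≡∣p∣+∣q─p∣ (false ∷ p) (false ∷ q) = ∣p∪q∣≡∣p∣+∣q─p∣ p q

∣g∣≡∣S∣+∣g─S∣ : ∀ {n} {S g : Subset n} → S ⊆ g → ∣ g ∣ ≡ ∣ S ∣ + ∣ g ─ S ∣
∣g∣≡∣S∣+∣g─S∣ {S = S} {g} S⊆g =
  trans (∣p∣≡∣p∩q∣+∣p─q∣ g S) (cong (λ A → ∣ A ∣ + ∣ g ─ S ∣) g∩S≡S)
  where
  g∩S≡S : g ∩ S ≡ S
  g∩S≡S = ⊆-antisym (p∩q⊆q g S) (λ x∈S → x∈p∩q⁺ (S⊆g x∈S , x∈S))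

x∈p─q⇒x∉q : ∀ {n} (p q : Subset n) {x} → x ∈ p ─ q → x ∉ q
x∈p─q⇒x∉q (_ ∷ p) (true ∷ q) () here
x∈p─q⇒x∉q (_ ∷ p) (_ ∷ q) (there x∈) (there x∈q) = x∈p─q⇒x∉q p q x∈ x∈q

positive⇒nonempty : ∀ {n} (p : Subset n) → 0 < ∣ p ∣ → Nonempty p
positive⇒nonempty {n} p pos with nonempty? p
... | yes ne = ne
... | no ¬ne = contradiction (trans (cong ∣_∣ (Empty-unique ¬ne)) (∣⊥∣≡0 n)) (>⇒≢ pos)

smaller⇒point-outside : ∀ {n} (p q : Subset n) → ∣ q ∣ < ∣ p ∣ → Nonempty (p ─ q)
smaller⇒point-outside p q ∣q∣<∣p∣ = positive⇒nonempty (p ─ q) (+-cancelˡ-< ∣ q ∣ 0 _ (begin-strict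
  ∣ q ∣ + 0               ≡⟨ +-identityʳ ∣ q ∣ ⟩
  ∣ q ∣                   <⟨ ∣q∣<∣p∣ ⟩
  ∣ p ∣                   ≡⟨ ∣p∣≡∣p∩q∣+∣p─q∣ p q ⟩
  ∣ p ∩ q ∣ + ∣ p ─ q ∣   ≤⟨ +-monoˡ-≤ ∣ p ─ q ∣ (∣p∩q∣≤∣q∣ p q) ⟩
  ∣ q ∣ + ∣ p ─ q ∣       ∎))
  where open ≤-Reasoning

⊆∧∣∣≥⇒⊇ : ∀ {n} {p q : Subset n} → p ⊆ q → ∣ q ∣ ≤ ∣ p ∣ → q ⊆ p
⊆∧∣∣≥⇒⊇ {p = p} {q} p⊆q ∣q∣≤∣p∣ {x} x∈q with x ∈? p
... | yes x∈p = x∈p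
... | no x∉p = contradiction ∣q∣≤∣p∣ (<⇒≱ (p⊂q⇒∣p∣<∣q∣ (p⊆q , x , x∈q , x∉p)))

∣p∣≤1⇒subsingleton : ∀ {n} {p : Subset n} {x y : Fin n} → ∣ p ∣ ≤ 1 → x ∈ p → y ∈ p → x ≡ y
∣p∣≤1⇒subsingleton {p = p} {x} {y} ∣p∣≤1 x∈p y∈p with x Data.Fin.≟ y
... | yes x≡y = x≡y
... | no x≢y = contradiction ∣p∣≤1 (<⇒≱ (begin-strict
  1             ≡⟨ sym (∣⁅x⁆∣≡1 y) ⟩
  ∣ ⁅ y ⁆ ∣     ≤⟨ p⊆q⇒∣p∣≤∣q∣ ⁅y⁆⊆p-x ⟩
  ∣ p - x ∣     <⟨ x∈p⇒∣p-x∣<∣p∣ x∈p ⟩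
  ∣ p ∣         ∎))
  where
  open ≤-Reasoning
  ⁅y⁆⊆p-x : ⁅ y ⁆ ⊆ p - x
  ⁅y⁆⊆p-x z∈⁅y⁆ with x∈⁅y⁆⇒x≡y y z∈⁅y⁆
  ... | refl = x∈p∧x≢y⇒x∈p-y y∈p (x≢y ∘ sym)

InjOn : ∀ {m n} → (Fin m → Fin n) → Subset m → Set
InjOn φ A = ∀ {x y} → x ∈ A → y ∈ A → φ x ≡ φ y → x ≡ y

InjOn-⊆ : ∀ {m n} {φ : Fin m → Fin n} {A B : Subset m} → A ⊆ B → InjOn φ B → InjOn φ A
InjOn-⊆ A⊆B inj x∈A y∈A = inj (A⊆B x∈A) (A⊆B y∈A)

image : ∀ {m n} → (Fin m → Fin n) → Subset m → Subset n
image φ []          = ⊥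
image φ (true ∷ A)  = ⁅ φ zero ⁆ ∪ image (λ x → φ (suc x)) A
image φ (false ∷ A) = image (λ x → φ (suc x)) A

∈-image⁺ : ∀ {m n} (φ : Fin m → Fin n) (A : Subset m) {x} → x ∈ A → φ x ∈ image φ A
∈-image⁺ φ (true ∷ A)  here        = x∈p∪q⁺ (inj₁ (x∈⁅x⁆ (φ zero)))
∈-image⁺ φ (true ∷ A)  (there x∈A) = x∈p∪q⁺ (inj₂ (∈-image⁺ (λ x → φ (suc x)) A x∈A))
∈-image⁺ φ (false ∷ A) (there x∈A) = ∈-image⁺ (λ x → φ (suc x)) A x∈A

∈-image⁻ : ∀ {m n} (φ : Fin m → Fin n) (A : Subset m) {y} → y ∈ image φ A → ∃[ x ] (x ∈ A × φ x ≡ y)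
∈-image⁻ φ []          y∈ = ⊥-elim (∉⊥ y∈)
∈-image⁻ φ (true ∷ A)  y∈ with x∈p∪q⁻ ⁅ φ zero ⁆ (image (λ x → φ (suc x)) A) y∈
... | inj₁ y∈⁅φ0⁆ = zero , here , sym (x∈⁅y⁆⇒x≡y _ y∈⁅φ0⁆)
... | inj₂ y∈rest with ∈-image⁻ (λ x → φ (suc x)) A y∈rest
...   | x , x∈A , φx≡y = suc x , there x∈A , φx≡y
∈-image⁻ φ (false ∷ A) y∈ with ∈-image⁻ (λ x → φ (suc x)) A y∈
... | x , x∈A , φx≡y = suc x , there x∈A , φx≡y

∉-image-of-empty : ∀ {m n} (φ : Fin m → Fin n) (A : Subset m) → (∀ {x} → x ∉ A) → ∀ {y} → y ∉ image φ A
∉-image-of-empty φ A empty y∈ = empty (proj₁ (proj₂ (∈-image⁻ φ A y∈)))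

image-mono : ∀ {m n} (φ : Fin m → Fin n) {A B : Subset m} → A ⊆ B → image φ A ⊆ image φ B
image-mono φ {A} {B} A⊆B y∈ with ∈-image⁻ φ A y∈
... | x , x∈A , refl = ∈-image⁺ φ B (A⊆B x∈A)

image-cong : ∀ {m n} (φ ψ : Fin m → Fin n) (A : Subset m) → (∀ {x} → x ∈ A → φ x ≡ ψ x) → image φ A ≡ image ψ A
image-cong φ ψ []          _     = refl
image-cong φ ψ (true ∷ A)  agree =
  cong₂ (λ y B → ⁅ y ⁆ ∪ B) (agree here) (image-cong _ _ A (agree ∘ there))
image-cong φ ψ (false ∷ A) agree = image-cong _ _ A (agree ∘ there)

∣⁅y⁆∪B∣ : ∀ {n} (y : Fin n) (B : Subset n) → y ∉ B → ∣ ⁅ y ⁆ ∪ B ∣ ≡ suc ∣ B ∣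
∣⁅y⁆∪B∣ zero    (true ∷ B)  y∉B = ⊥-elim (y∉B here)
∣⁅y⁆∪B∣ zero    (false ∷ B) y∉B = cong (λ C → suc ∣ C ∣) (∪-identityˡ B)
∣⁅y⁆∪B∣ (suc y) (true ∷ B)  y∉B = cong suc (∣⁅y⁆∪B∣ y B (y∉B ∘ there))
∣⁅y⁆∪B∣ (suc y) (false ∷ B) y∉B = ∣⁅y⁆∪B∣ y B (y∉B ∘ there)

∣image∣ : ∀ {m n} (φ : Fin m → Fin n) (A : Subset m) → InjOn φ A → ∣ image φ A ∣ ≡ ∣ A ∣
∣image∣ {n = n} φ []          _   = ∣⊥∣≡0 n
∣image∣ φ (true ∷ A)  inj =
  trans (∣⁅y⁆∪B∣ (φ zero) _ φ0∉rest) (cong suc (∣image∣ (λ x → φ (suc x)) A inj-tail))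
  where
  inj-tail : InjOn (λ x → φ (suc x)) A
  inj-tail x∈ y∈ eq = Data.Fin.Properties.suc-injective (inj (there x∈) (there y∈) eq)
  φ0∉rest : φ zero ∉ image (λ x → φ (suc x)) A
  φ0∉rest y∈ with ∈-image⁻ (λ x → φ (suc x)) A y∈
  ... | x , x∈A , eq with inj (there x∈A) here eq
  ... | ()
∣image∣ φ (false ∷ A) inj =
  ∣image∣ (λ x → φ (suc x)) A (λ x∈ y∈ eq → Data.Fin.Properties.suc-injective (inj (there x∈) (there y∈) eq))

_◃_ : ∀ {m n} → Fin n → (Fin m → Fin n) → Fin (suc m) → Fin n
(y ◃ f) zero    = y
(y ◃ f) (suc x) = f x

redefine-injectively : ∀ {m n} (f : Fin m → Fin n) (A : Subset m) (B : Subset n) → ∣ A ∣ ≤ ∣ B ∣ →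
  ∃[ χ ] ((∀ {x} → x ∉ A → χ x ≡ f x) × InjOn χ A × image χ A ⊆ B)
redefine-injectively f [] B _ = f , (λ _ → refl) , (λ ()) , (⊥-elim ∘ ∉⊥)
redefine-injectively f (false ∷ A) B ∣A∣≤∣B∣
  with redefine-injectively (λ x → f (suc x)) A B ∣A∣≤∣B∣
... | χ , keeps , inj , into = f zero ◃ χ , keeps′ , inj′ , into
  where
  keeps′ : ∀ {x} → x ∉ false ∷ A → (f zero ◃ χ) x ≡ f x
  keeps′ {zero}  _   = refl
  keeps′ {suc x} x∉ = keeps (x∉ ∘ there)
  inj′ : InjOn (f zero ◃ χ) (false ∷ A)
  inj′ (there x∈) (there y∈) eq = cong suc (inj x∈ y∈ eq)
redefine-injectively {n = n} f (true ∷ A) B ∣A∣<∣B∣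
  with redefine-injectively (λ x → f (suc x)) A B (<⇒≤ ∣A∣<∣B∣)
... | χ , keeps , inj , into
  with smaller⇒point-outside B (image χ A) (subst (_< ∣ B ∣) (sym (∣image∣ χ A inj)) ∣A∣<∣B∣)
...   | w , w∈B─X = w ◃ χ , keeps′ , inj′ , into′
  where
  X : Subset n
  X = image χ A
  w∉X : w ∉ X
  w∉X = x∈p─q⇒x∉q B X w∈B─X
  keeps′ : ∀ {x} → x ∉ true ∷ A → (w ◃ χ) x ≡ f x
  keeps′ {zero}  x∉ = ⊥-elim (x∉ here)
  keeps′ {suc x} x∉ = keeps (x∉ ∘ there)
  inj′ : InjOn (w ◃ χ) (true ∷ A)
  inj′ here       here       _  = refl
  inj′ here       (there y∈) eq = ⊥-elim (w∉X (subst (_∈ X) (sym eq) (∈-image⁺ χ A y∈)))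
  inj′ (there x∈) here       eq = ⊥-elim (w∉X (subst (_∈ X) eq (∈-image⁺ χ A x∈)))
  inj′ (there x∈) (there y∈) eq = cong suc (inj x∈ y∈ eq)
  into′ : ⁅ w ⁆ ∪ X ⊆ B
  into′ y∈ with x∈p∪q⁻ ⁅ w ⁆ X y∈
  ... | inj₁ y∈⁅w⁆ rewrite x∈⁅y⁆⇒x≡y w y∈⁅w⁆ = p─q⊆p B X w∈B─X
  ... | inj₂ y∈X   = into y∈X

Covers : ∀ {n} → Subset n → Subset n → Set
Covers S g = S ⊆ g × ∣ g ∣ ≡ suc ∣ S ∣

covers⇒∣g─S∣≡1 : ∀ {n} {S g : Subset n} → Covers S g → ∣ g ─ S ∣ ≡ 1
covers⇒∣g─S∣≡1 {S = S} {g} (S⊆g , ∣g∣≡1+∣S∣) = +-cancelˡ-≡ ∣ S ∣ _ _ (begin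
  ∣ S ∣ + ∣ g ─ S ∣   ≡⟨ sym (∣g∣≡∣S∣+∣g─S∣ S⊆g) ⟩
  ∣ g ∣               ≡⟨ ∣g∣≡1+∣S∣ ⟩
  suc ∣ S ∣           ≡⟨ +-comm 1 ∣ S ∣ ⟩
  ∣ S ∣ + 1           ∎)
  where open ≡-Reasoning

covers⇒unique-new : ∀ {n} {S g : Subset n} {x y} → Covers S g → x ∈ g ─ S → y ∈ g ─ S → x ≡ y
covers⇒unique-new cov = ∣p∣≤1⇒subsingleton (≤-reflexive (covers⇒∣g─S∣≡1 cov))

covers-same-point : ∀ {n} {S g g′ : Subset n} {w} → Covers S g → Covers S g′ → w ∈ g ─ S → w ∈ g′ → g ≡ g′
covers-same-point {S = S} {g} {g′} {w} cov@(_ , ∣g∣≡1+∣S∣) (S⊆g′ , ∣g′∣≡1+∣S∣) w∈g─S w∈g′ =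
  ⊆-antisym g⊆g′ (⊆∧∣∣≥⇒⊇ g⊆g′ (≤-reflexive (trans ∣g′∣≡1+∣S∣ (sym ∣g∣≡1+∣S∣))))
  where
  g⊆g′ : g ⊆ g′
  g⊆g′ {y} y∈g with y ∈? S
  ... | yes y∈S = S⊆g′ y∈S
  ... | no y∉S with covers⇒unique-new cov w∈g─S (x∈p∧x∉q⇒x∈p─q y∈g y∉S)
  ...   | refl = w∈g′

covers-leaving : ∀ {n} {S g X : Subset n} {w} → Covers S g → S ⊆ X → w ∈ g → w ∉ X →
  ∀ {y} → y ∈ g → y ∈ X → y ∈ S
covers-leaving {S = S} cov S⊆X w∈g w∉X {y} y∈g y∈X with y ∈? S
... | yes y∈S = y∈S
... | no y∉S with covers⇒unique-new cov (x∈p∧x∉q⇒x∈p─q y∈g y∉S) (x∈p∧x∉q⇒x∈p─q w∈g (w∉X ∘ S⊆X))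
...   | refl = ⊥-elim (w∉X y∈X)

-- Distinct sets covering S inside X have distinct new points in X ∖ S,
-- so there are at most |X ∖ S| of them.
covers-inside-bound : ∀ {n} (S X : Subset n) (C : List (Subset n)) → Unique C →
  All (λ g → Covers S g × g ⊆ X) C → length C ≤ ∣ X ─ S ∣
covers-inside-bound S X []      _                   _                    = z≤n
covers-inside-bound S X (g ∷ C) (g∉C ∷ unique-C) ((cov , g⊆X) ∷ rest)
  with positive⇒nonempty (g ─ S) (≤-reflexive (sym (covers⇒∣g─S∣≡1 cov)))
... | w , w∈g─S = begin-strict
  length C              ≤⟨ covers-inside-bound S (X - w) C unique-C (avoid-w g∉C rest) ⟩
  ∣ X - w ─ S ∣         ≡⟨ cong ∣_∣ (p─q─r≡p─r─q X ⁅ w ⁆ S) ⟩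
  ∣ X ─ S - w ∣         <⟨ x∈p⇒∣p-x∣<∣p∣ w∈X─S ⟩
  ∣ X ─ S ∣             ∎
  where
  open ≤-Reasoning
  w∈X─S : w ∈ X ─ S
  w∈X─S = x∈p∧x∉q⇒x∈p─q (g⊆X (p─q⊆p g S w∈g─S)) (x∈p─q⇒x∉q g S w∈g─S)
  avoid-w : ∀ {C} → All (g ≢_) C → All (λ g′ → Covers S g′ × g′ ⊆ X) C →
    All (λ g′ → Covers S g′ × g′ ⊆ X - w) C
  avoid-w []            []                     = []
  avoid-w (g≢g′ ∷ g≢s) ((cov′ , g′⊆X) ∷ rest′) =
    (cov′ , λ y∈g′ → x∈p∧x≢y⇒x∈p-y (g′⊆X y∈g′) λ { refl → g≢g′ (covers-same-point cov cov′ w∈g─S y∈g′) })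
    ∷ avoid-w g≢s rest′

covers-escape : ∀ {n} (S X : Subset n) (C : List (Subset n)) → Unique C → All (Covers S) C →
  ∣ X ─ S ∣ < length C → Any (λ g → ∃[ w ] (w ∈ g × w ∉ X)) C
covers-escape S X C unique-C cov big
  with any? (λ g → anyFin? (λ w → (w ∈? g) ×-dec ¬? (w ∈? X))) C
... | yes leaving = leaving
... | no ¬leaving = contradiction (covers-inside-bound S X C unique-C all-inside) (<⇒≱ big)
  where
  all-inside : All (λ g → Covers S g × g ⊆ X) C
  all-inside = All.tabulate λ {g} g∈C → All.lookup cov g∈C , λ {w} w∈g →
    Relation.Nullary.decidable-stable (w ∈? X) λ w∉X → ¬leaving (lose g∈C (w , w∈g , w∉X))

-- The one-edge extension lemma.

module ExtendOnto {m n : ℕ} (φ : Fin m → Fin n) (P e : Subset m) (g : Subset n)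
  (inj : InjOn φ P) (∣e∣≡∣g∣ : ∣ e ∣ ≡ ∣ g ∣) (φI⊆g : image φ (e ∩ P) ⊆ g)
  (meets : ∀ {y} → y ∈ g → y ∈ image φ P → y ∈ image φ (e ∩ P)) where

  S : Subset n
  S = image φ (e ∩ P)

  ∣e─P∣≡∣g─S∣ : ∣ e ─ P ∣ ≡ ∣ g ─ S ∣
  ∣e─P∣≡∣g─S∣ = +-cancelˡ-≡ ∣ e ∩ P ∣ _ _ (begin
    ∣ e ∩ P ∣ + ∣ e ─ P ∣   ≡⟨ sym (∣p∣≡∣p∩q∣+∣p─q∣ e P) ⟩
    ∣ e ∣                   ≡⟨ ∣e∣≡∣g∣ ⟩
    ∣ g ∣                   ≡⟨ ∣g∣≡∣S∣+∣g─S∣ φI⊆g ⟩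
    ∣ S ∣ + ∣ g ─ S ∣       ≡⟨ cong (_+ ∣ g ─ S ∣) (∣image∣ φ (e ∩ P) (InjOn-⊆ (p∩q⊆q e P) inj)) ⟩
    ∣ e ∩ P ∣ + ∣ g ─ S ∣   ∎)
    where open ≡-Reasoning

  redefined : ∃[ χ ] ((∀ {x} → x ∉ e ─ P → χ x ≡ φ x) × InjOn χ (e ─ P) × image χ (e ─ P) ⊆ g ─ S)
  redefined = redefine-injectively φ (e ─ P) (g ─ S) (≤-reflexive ∣e─P∣≡∣g─S∣)

  ψ : Fin m → Fin n
  ψ = proj₁ redefined

  ψ-agrees : ∀ {x} → x ∈ P → ψ x ≡ φ x
  ψ-agrees x∈P = proj₁ (proj₂ redefined) (λ x∈e─P → x∈p─q⇒x∉q e P x∈e─P x∈P)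

  ψ-inj-new : InjOn ψ (e ─ P)
  ψ-inj-new = proj₁ (proj₂ (proj₂ redefined))

  ψ-new : ∀ {x} → x ∈ e → x ∉ P → ψ x ∈ g ─ S
  ψ-new x∈e x∉P = proj₂ (proj₂ (proj₂ redefined)) (∈-image⁺ ψ (e ─ P) (x∈p∧x∉q⇒x∈p─q x∈e x∉P))

  ψ-new∉φP : ∀ {x y} → x ∈ e → x ∉ P → y ∈ P → ψ x ≢ ψ y
  ψ-new∉φP {x} {y} x∈e x∉P y∈P ψx≡ψy =
    x∈p─q⇒x∉q g S (ψ-new x∈e x∉P) (meets (p─q⊆p g S (ψ-new x∈e x∉P)) ψx∈φP)
    where
    ψx∈φP : ψ x ∈ image φ P
    ψx∈φP = subst (_∈ image φ P) (sym (trans ψx≡ψy (ψ-agrees y∈P))) (∈-image⁺ φ P y∈P)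

  new-vertex : ∀ {z} → z ∈ P ∪ e → z ∉ P → z ∈ e
  new-vertex z∈ z∉P with x∈p∪q⁻ P e z∈
  ... | inj₁ z∈P = ⊥-elim (z∉P z∈P)
  ... | inj₂ z∈e = z∈e

  injective : InjOn ψ (P ∪ e)
  injective {x} {y} x∈ y∈ ψx≡ψy with x ∈? P | y ∈? P
  ... | yes x∈P | yes y∈P = inj x∈P y∈P (trans (sym (ψ-agrees x∈P)) (trans ψx≡ψy (ψ-agrees y∈P)))
  ... | yes x∈P | no y∉P  = ⊥-elim (ψ-new∉φP (new-vertex y∈ y∉P) y∉P x∈P (sym ψx≡ψy))
  ... | no x∉P  | yes y∈P = ⊥-elim (ψ-new∉φP (new-vertex x∈ x∉P) x∉P y∈P ψx≡ψy)
  ... | no x∉P  | no y∉P  = ψ-inj-new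
    (x∈p∧x∉q⇒x∈p─q (new-vertex x∈ x∉P) x∉P) (x∈p∧x∉q⇒x∈p─q (new-vertex y∈ y∉P) y∉P) ψx≡ψy

  image⊆g : image ψ e ⊆ g
  image⊆g y∈ with ∈-image⁻ ψ e y∈
  ... | x , x∈e , refl with x ∈? P
  ...   | yes x∈P = subst (_∈ g) (sym (ψ-agrees x∈P)) (φI⊆g (∈-image⁺ φ (e ∩ P) (x∈p∩q⁺ (x∈e , x∈P))))
  ...   | no x∉P  = p─q⊆p g S (ψ-new x∈e x∉P)

  onto : image ψ e ≡ g
  onto = ⊆-antisym image⊆g (⊆∧∣∣≥⇒⊇ image⊆g (≤-reflexive (trans (sym ∣e∣≡∣g∣)
    (sym (∣image∣ ψ e (InjOn-⊆ (q⊆p∪q P e) injective))))))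

extend-onto : ∀ {m n} (φ : Fin m → Fin n) (P e : Subset m) (g : Subset n) → InjOn φ P → ∣ e ∣ ≡ ∣ g ∣ →
  image φ (e ∩ P) ⊆ g → (∀ {y} → y ∈ g → y ∈ image φ P → y ∈ image φ (e ∩ P)) →
  ∃[ ψ ] ((∀ {x} → x ∈ P → ψ x ≡ φ x) × InjOn ψ (P ∪ e) × image ψ e ≡ g)
extend-onto φ P e g inj ∣e∣≡∣g∣ φI⊆g meets = ψ , ψ-agrees , injective , onto
  where open ExtendOnto φ P e g inj ∣e∣≡∣g∣ φI⊆g meets

⋃-++ : ∀ {m} (xs ys : List (Subset m)) → ⋃ (xs ++ ys) ≡ ⋃ xs ∪ ⋃ ys
⋃-++ []       ys = sym (∪-identityˡ (⋃ ys))
⋃-++ (x ∷ xs) ys = trans (cong (x ∪_) (⋃-++ xs ys)) (sym (∪-assoc x (⋃ xs) (⋃ ys)))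

⊆⋃ : ∀ {m} (xs : List (Subset m)) → All (_⊆ ⋃ xs) xs
⊆⋃ []       = []
⊆⋃ (x ∷ xs) = p⊆p∪q (⋃ xs) ∷ All.map (λ x′⊆ {y} y∈ → q⊆p∪q x (⋃ xs) (x′⊆ y∈)) (⊆⋃ xs)

prefixUnion-suc : ∀ {m} (es : List (Subset m)) (i : Fin (length es)) →
  prefixUnion es (suc (toℕ i)) ≡ prefixUnion es (toℕ i) ∪ lookup es i
prefixUnion-suc es i = begin
  ⋃ (take (suc (toℕ i)) es)                  ≡⟨ cong ⋃ (take-suc es i) ⟩
  ⋃ (take (toℕ i) es ++ lookup es i ∷ [])    ≡⟨ ⋃-++ (take (toℕ i) es) (lookup es i ∷ []) ⟩
  ⋃ (take (toℕ i) es) ∪ (lookup es i ∪ ⊥)    ≡⟨ cong (⋃ (take (toℕ i) es) ∪_) (∪-identityʳ (lookup es i)) ⟩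
  ⋃ (take (toℕ i) es) ∪ lookup es i          ∎
  where open ≡-Reasoning

lookup∈take : ∀ {A : Set} (xs : List A) (j : Fin (length xs)) (k : ℕ) → toℕ j < k → lookup xs j ∈ₗ take k xs
lookup∈take (x ∷ xs) zero    (suc k) _         = here refl
lookup∈take (x ∷ xs) (suc j) (suc k) (s≤s j<k) = there (lookup∈take xs j k j<k)

index-induction : ∀ {a} {A : Set} (xs : List A) (Q : ℕ → Set a) → Q 0 →
  ((i : Fin (length xs)) → Q (toℕ i) → Q (suc (toℕ i))) → (k : ℕ) → k ≤ length xs → Q k
index-induction xs Q base step zero    _  = base
index-induction xs Q base step (suc k) lt =
  subst Q (cong suc k-th) (step i (subst Q (sym k-th) (index-induction xs Q base step k (<⇒≤ lt))))
  where
  i : Fin (length xs)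
  i = fromℕ< lt
  k-th : toℕ i ≡ k
  k-th = toℕ-fromℕ< lt

1+[r∸1]≡r : ∀ {r} → 1 ≤ r → suc (r ∸ 1) ≡ r
1+[r∸1]≡r (s≤s z≤n) = refl

-- In a tight ordering of r-sets, every edge after the first adds exactly one
-- new vertex, so the first k edges span at most (r - 1) + k vertices.
module TightPrefixes {m r : ℕ} (r≥1 : 1 ≤ r) (es : List (Subset m))
  (uniform-es : All (λ e → ∣ e ∣ ≡ r) es) (tight : TightOrdering r es) where

  P : ℕ → Subset m
  P = prefixUnion es

  ∣edge∣ : (i : Fin (length es)) → ∣ lookup es i ∣ ≡ r
  ∣edge∣ i = All.lookup uniform-es (∈-lookup i)

  one-new-vertex : (i : Fin (length es)) → 0 < toℕ i → ∣ lookup es i ─ P (toℕ i) ∣ ≡ 1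
  one-new-vertex i pos = +-cancelˡ-≡ (r ∸ 1) _ _ (begin
    (r ∸ 1) + ∣ e ─ Q ∣     ≡⟨ cong (_+ ∣ e ─ Q ∣) (sym (proj₂ tight i pos)) ⟩
    ∣ e ∩ Q ∣ + ∣ e ─ Q ∣   ≡⟨ sym (∣p∣≡∣p∩q∣+∣p─q∣ e Q) ⟩
    ∣ e ∣                   ≡⟨ ∣edge∣ i ⟩
    r                       ≡⟨ sym (1+[r∸1]≡r r≥1) ⟩
    suc (r ∸ 1)             ≡⟨ +-comm 1 (r ∸ 1) ⟩
    (r ∸ 1) + 1             ∎)
    where
    open ≡-Reasoning
    e Q : Subset m
    e = lookup es i
    Q = P (toℕ i)

  size-step : (i : Fin (length es)) → ∣ P (toℕ i) ∣ ≤ (r ∸ 1) + toℕ i →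
    ∣ P (suc (toℕ i)) ∣ ≤ (r ∸ 1) + suc (toℕ i)
  size-step i bound rewrite prefixUnion-suc es i | ∣p∪q∣≡∣p∣+∣q─p∣ (P (toℕ i)) (lookup es i)
    with toℕ i ≟ 0
  ... | yes k≡0 = begin
    ∣ Q ∣ + ∣ e ─ Q ∣       ≡⟨ cong (_+ ∣ e ─ Q ∣) (trans (cong (∣_∣ ∘ P) k≡0) (∣⊥∣≡0 m)) ⟩
    ∣ e ─ Q ∣               ≤⟨ ∣p─q∣≤∣p∣ e Q ⟩
    ∣ e ∣                   ≡⟨ trans (∣edge∣ i) (sym (1+[r∸1]≡r r≥1)) ⟩
    suc (r ∸ 1)             ≡⟨ +-comm 1 (r ∸ 1) ⟩
    (r ∸ 1) + 1             ≤⟨ +-monoʳ-≤ (r ∸ 1) (s≤s z≤n) ⟩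
    (r ∸ 1) + suc (toℕ i)   ∎
    where
    open ≤-Reasoning
    e Q : Subset m
    e = lookup es i
    Q = P (toℕ i)
  ... | no k≢0 = begin
    ∣ Q ∣ + ∣ e ─ Q ∣       ≡⟨ cong (∣ Q ∣ +_) (one-new-vertex i (n≢0⇒n>0 k≢0)) ⟩
    ∣ Q ∣ + 1               ≤⟨ +-monoˡ-≤ 1 bound ⟩
    (r ∸ 1) + toℕ i + 1     ≡⟨ +-assoc (r ∸ 1) (toℕ i) 1 ⟩
    (r ∸ 1) + (toℕ i + 1)   ≡⟨ cong ((r ∸ 1) +_) (+-comm (toℕ i) 1) ⟩
    (r ∸ 1) + suc (toℕ i)   ∎
    where
    open ≤-Reasoning
    e Q : Subset m
    e = lookup es i
    Q = P (toℕ i)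

  prefix-size : (k : ℕ) → k ≤ length es → ∣ P k ∣ ≤ (r ∸ 1) + k
  prefix-size = index-induction es (λ k → ∣ P k ∣ ≤ (r ∸ 1) + k)
    (subst (_≤ r ∸ 1 + 0) (sym (∣⊥∣≡0 m)) z≤n) size-step

-- The greedy embedding.

codeg : ∀ {n} → Subset n → List (Subset n) → ℕ
codeg S E = length (filter (S ⊆?_) E)

module GreedyEmbedding {m n r : ℕ} (r≥1 : 1 ≤ r) (es : List (Subset m))
  (uniform-es : All (λ e → ∣ e ∣ ≡ r) es) (tight : TightOrdering r es)
  (G : RGraph r n) {g₀ : Subset n} (g₀∈G : g₀ ∈ₗ edges G)
  (high : ∀ S → InShadow r (edges G) S → length es ≤ codeg S (edges G)) where

  open TightPrefixes r≥1 es uniform-es tight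

  E : List (Subset n)
  E = edges G

  Embedded : ℕ → Set
  Embedded k = ∃[ φ ] (InjOn φ (P k) × All (λ e → image φ e ∈ₗ E) (take k es))

  Target : (Fin m → Fin n) → Subset m → Subset m → Set
  Target φ Q e = ∃[ g ] (g ∈ₗ E × image φ (e ∩ Q) ⊆ g ×
    (∀ {y} → y ∈ g → y ∈ image φ Q → y ∈ image φ (e ∩ Q)))

  first-target : ∀ φ Q e → (∀ {x} → x ∉ Q) → Target φ Q e
  first-target φ Q e Q-empty =
    g₀ , g₀∈G , ⊥-elim ∘ ∉-image-of-empty φ (e ∩ Q) (Q-empty ∘ p∩q⊆q e Q) ,
    λ _ y∈φQ → ⊥-elim (∉-image-of-empty φ Q Q-empty y∈φQ)

  -- A later edge e: S = φ(e ∩ Q) is an (r-1)-set inside the image of an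
  -- earlier edge, hence in the shadow, so it lies in ≥ length es > toℕ i edges;
  -- at most |φ(Q) ∖ S| ≤ toℕ i of them stay inside φ(Q).
  tight-target : (i : Fin (length es)) → 0 < toℕ i → (φ : Fin m → Fin n) → InjOn φ (P (toℕ i)) →
    All (λ e → image φ e ∈ₗ E) (take (toℕ i) es) → Target φ (P (toℕ i)) (lookup es i)
  tight-target i pos φ inj mapped = leave (find (covers-escape S X C unique-C covers few-inside))
    where
    k : ℕ
    k = toℕ i
    Q e : Subset m
    Q = P k
    e = lookup es i
    S X : Subset n
    S = image φ (e ∩ Q)
    X = image φ Q
    C : List (Subset n)
    C = filter (S ⊆?_) E
    earlier : ∃[ i′ ] (toℕ i′ < k × e ∩ Q ⊆ lookup es i′)
    earlier = proj₁ tight i pos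
    ∣S∣≡r∸1 : ∣ S ∣ ≡ r ∸ 1
    ∣S∣≡r∸1 = trans (∣image∣ φ (e ∩ Q) (InjOn-⊆ (p∩q⊆q e Q) inj)) (proj₂ tight i pos)
    S∈∂G : InShadow r E S
    S∈∂G = ∣S∣≡r∸1 , lose (All.lookup mapped (lookup∈take es (proj₁ earlier) k (proj₁ (proj₂ earlier))))
                          (image-mono φ (proj₂ (proj₂ earlier)))
    unique-C : Unique C
    unique-C = UniqueP.filter⁺ (S ⊆?_) (unique G)
    covers : All (Covers S) C
    covers = All.tabulate λ g∈C → let (g∈E , S⊆g) = ∈-filter⁻ (S ⊆?_) {xs = E} g∈C in
      S⊆g , trans (All.lookup (uniform G) g∈E) (sym (trans (cong suc ∣S∣≡r∸1) (1+[r∸1]≡r r≥1)))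
    few-inside : ∣ X ─ S ∣ < length C
    few-inside = begin-strict
      ∣ X ─ S ∣   ≤⟨ +-cancelˡ-≤ ∣ S ∣ _ _ (begin
                       ∣ S ∣ + ∣ X ─ S ∣   ≡⟨ sym (∣g∣≡∣S∣+∣g─S∣ (image-mono φ (p∩q⊆q e Q))) ⟩
                       ∣ X ∣               ≡⟨ ∣image∣ φ Q inj ⟩
                       ∣ Q ∣               ≤⟨ prefix-size k (<⇒≤ (toℕ<n i)) ⟩
                       (r ∸ 1) + k         ≡⟨ cong (_+ k) (sym ∣S∣≡r∸1) ⟩
                       ∣ S ∣ + k           ∎) ⟩
      k           <⟨ toℕ<n i ⟩
      length es   ≤⟨ high S S∈∂G ⟩
      length C    ∎
      where open ≤-Reasoning
    leave : ∃[ g ] (g ∈ₗ C × ∃[ w ] (w ∈ g × w ∉ X)) → Target φ Q e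
    leave (g , g∈C , w , w∈g , w∉X) = g , proj₁ (∈-filter⁻ (S ⊆?_) {xs = E} g∈C) , proj₁ cov ,
      covers-leaving cov (image-mono φ (p∩q⊆q e Q)) w∈g w∉X
      where
      cov : Covers S g
      cov = All.lookup covers g∈C

  next-target : (i : Fin (length es)) (φ : Fin m → Fin n) → InjOn φ (P (toℕ i)) →
    All (λ e → image φ e ∈ₗ E) (take (toℕ i) es) → Target φ (P (toℕ i)) (lookup es i)
  next-target i φ inj mapped with toℕ i ≟ 0
  ... | yes k≡0 = first-target φ (P (toℕ i)) (lookup es i) (λ x∈ → ∉⊥ (subst (λ k → _ ∈ P k) k≡0 x∈))
  ... | no k≢0  = tight-target i (n≢0⇒n>0 k≢0) φ inj mapped

  grow : (i : Fin (length es)) → Embedded (toℕ i) → Embedded (suc (toℕ i))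
  grow i (φ , inj , mapped) with next-target i φ inj mapped
  ... | g , g∈E , φI⊆g , meets
    with extend-onto φ (P (toℕ i)) (lookup es i) g inj
           (trans (∣edge∣ i) (sym (All.lookup (uniform G) g∈E))) φI⊆g meets
  ... | ψ , agrees , injψ , onto =
    ψ , subst (InjOn ψ) (sym (prefixUnion-suc es i)) injψ ,
    subst (All (λ e → image ψ e ∈ₗ E)) (sym (take-suc es i))
      (AllP.∷ʳ⁺ (All.zipWith unchanged (⊆⋃ (take (toℕ i) es) , mapped)) (subst (_∈ₗ E) (sym onto) g∈E))
    where
    unchanged : ∀ {e} → e ⊆ P (toℕ i) × image φ e ∈ₗ E → image ψ e ∈ₗ E
    unchanged {e} (e⊆Q , φe∈E) = subst (_∈ₗ E) (image-cong φ ψ e (λ x∈e → sym (agrees (e⊆Q x∈e)))) φe∈E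

  start-vertex : Fin n
  start-vertex = proj₁ (positive⇒nonempty g₀ (subst (0 <_) (sym (All.lookup (uniform G) g₀∈G)) r≥1))

  embed : (k : ℕ) → k ≤ length es → Embedded k
  embed = index-induction es Embedded ((λ _ → start-vertex) , (λ x∈⊥ → ⊥-elim (∉⊥ x∈⊥)) , []) grow

copy-from-map : ∀ {r ℓ n} (T : TightTree r ℓ) (G : RGraph r n) (φ : Fin (m T) → Fin n) →
  (∀ {x y} → φ x ≡ φ y → x ≡ y) → All (λ e → image φ e ∈ₗ edges G) (edges (graph T)) → ContainsCopy G T
copy-from-map T G φ inj mapped = φ , inj , All.map (λ {e} φe∈G → image φ e , φe∈G , λ x →
  mk⇔ (∈-image⁻ φ e) (λ { (v , v∈e , refl) → ∈-image⁺ φ e v∈e })) mapped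

high-codegree⇒copy : ∀ {r ℓ n} → 1 ≤ r → (T : TightTree r ℓ) (G : RGraph r n) →
  (∀ S → InShadow r (edges G) S → ℓ ≤ codeg S (edges G)) → ∀ {g₀} → g₀ ∈ₗ edges G → ContainsCopy G T
high-codegree⇒copy {r} r≥1 T G high g₀∈G = from-ordering (ordering T)
  where
  from-ordering : ∃[ es ] (edges (graph T) ↭ es × TightOrdering r es) → ContainsCopy G T
  from-ordering (es , T↭es , tight) =
    from-embedding (GreedyEmbedding.embed r≥1 es (All-resp-↭ T↭es (uniform (graph T))) tight G g₀∈G
      high-es (length es) ≤-refl)
    where
    high-es : ∀ S → InShadow r (edges G) S → length es ≤ codeg S (edges G)
    high-es S S∈∂G = subst (_≤ codeg S (edges G)) (trans (sym (size T)) (↭-length T↭es)) (high S S∈∂G)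
    all-taken : take (length es) es ≡ es
    all-taken = take-all (length es) es ≤-refl
    covered : ∀ v → v ∈ prefixUnion es (length es)
    covered v with find (Any-resp-↭ T↭es (covering T v))
    ... | e , e∈es , v∈e = subst (v ∈_) (cong ⋃ (sym all-taken)) (All.lookup (⊆⋃ es) e∈es v∈e)
    from-embedding : ∃[ φ ] (InjOn φ (prefixUnion es (length es)) ×
      All (λ e → image φ e ∈ₗ edges G) (take (length es) es)) → ContainsCopy G T
    from-embedding (φ , injective , mapped) =
      copy-from-map T G φ (λ eq → injective (covered _) (covered _) eq)
        (All-resp-↭ (↭-sym T↭es) (subst (All _) all-taken mapped))

length-filter-split : ∀ {A : Set} {P : A → Set} (P? : Decidable P) (xs : List A) →
  length xs ≡ length (filter P? xs) + length (filter (¬? ∘ P?) xs)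
length-filter-split P? []       = refl
length-filter-split P? (x ∷ xs) with P? x
... | yes _ = cong suc (length-filter-split P? xs)
... | no _  = trans (cong suc (length-filter-split P? xs)) (sym (+-suc _ _))

filter-stronger : ∀ {A : Set} {P Q : A → Set} (P? : Decidable P) (Q? : Decidable Q) →
  (∀ {x} → Q x → P x) → (xs : List A) → filter Q? xs ≡ filter Q? (filter P? xs)
filter-stronger P? Q? Q⇒P []       = refl
filter-stronger P? Q? Q⇒P (x ∷ xs) with Q? x | P? x
... | yes qx | no ¬px = contradiction (Q⇒P qx) ¬px
... | yes qx | yes px rewrite filter-accept Q? {xs = filter P? xs} qx =
  cong (x ∷_) (filter-stronger P? Q? Q⇒P xs)
... | no ¬qx | yes px rewrite filter-reject Q? {xs = filter P? xs} ¬qx = filter-stronger P? Q? Q⇒P xs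
... | no ¬qx | no ¬px = filter-stronger P? Q? Q⇒P xs

filter-stronger-shorter : ∀ {A : Set} {P Q : A → Set} (P? : Decidable P) (Q? : Decidable Q) →
  (∀ {x} → Q x → P x) → (xs : List A) → ∀ {x} → x ∈ₗ xs → P x → ¬ Q x →
  length (filter Q? xs) < length (filter P? xs)
filter-stronger-shorter P? Q? Q⇒P xs x∈xs px ¬qx rewrite filter-stronger P? Q? Q⇒P xs =
  filter-notAll Q? (filter P? xs) (lose (∈-filter⁺ P? x∈xs px) ¬qx)

∈-allSubsets : ∀ {n} (S : Subset n) → S ∈ₗ allSubsets n
∈-allSubsets []          = here refl
∈-allSubsets (true ∷ S)  = ∈-++⁺ˡ (∈-map⁺ (true ∷_) (∈-allSubsets S))
∈-allSubsets {suc n} (false ∷ S) = ∈-++⁺ʳ (Data.List.map (true ∷_) (allSubsets n)) (∈-map⁺ (false ∷_) (∈-allSubsets S))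

no-members⇒empty : ∀ {A : Set} (xs : List A) → (∀ {x} → ¬ x ∈ₗ xs) → length xs ≡ 0
no-members⇒empty []       _    = refl
no-members⇒empty (x ∷ xs) none = ⊥-elim (none (here refl))

module Deletion {r n : ℕ} (S : Subset n) (G : RGraph r n) where

  E : List (Subset n)
  E = edges G

  G′ : RGraph r n
  G′ = record
    { edges   = filter (¬? ∘ (S ⊆?_)) E
    ; unique  = UniqueP.filter⁺ (¬? ∘ (S ⊆?_)) (unique G)
    ; uniform = AllP.filter⁺ (¬? ∘ (S ⊆?_)) (uniform G)
    }

  ∈G′⇒∈G : ∀ {g} → g ∈ₗ edges G′ → g ∈ₗ E
  ∈G′⇒∈G g∈G′ = proj₁ (∈-filter⁻ (¬? ∘ (S ⊆?_)) {xs = E} g∈G′)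

  copy-in-G : ∀ {ℓ} (T : TightTree r ℓ) → ContainsCopy G′ T → ContainsCopy G T
  copy-in-G T (φ , inj , mapped) =
    φ , inj , All.map (λ { (g , g∈G′ , spec) → g , ∈G′⇒∈G g∈G′ , spec }) mapped

  size-split : length E ≡ codeg S E + length (edges G′)
  size-split = length-filter-split (S ⊆?_) E

  -- ∂G′ ⊆ ∂G, and S ∈ ∂G leaves the shadow
  shadow-shrinks : InShadow r E S → ∣∂ G′ ∣ < ∣∂ G ∣
  shadow-shrinks S∈∂G =
    filter-stronger-shorter (inShadow? r E) (inShadow? r (edges G′)) ∂G′⊆∂G (allSubsets n)
      (∈-allSubsets S) S∈∂G S∉∂G′
    where
    ∂G′⊆∂G : ∀ {s} → InShadow r (edges G′) s → InShadow r E s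
    ∂G′⊆∂G (∣s∣ , through) with find through
    ... | g , g∈G′ , s⊆g = ∣s∣ , lose (∈G′⇒∈G g∈G′) s⊆g
    S∉∂G′ : ¬ InShadow r (edges G′) S
    S∉∂G′ (_ , through) with find through
    ... | g , g∈G′ , S⊆g = proj₂ (∈-filter⁻ (¬? ∘ (S ⊆?_)) {xs = E} g∈G′) S⊆g

module _ {r ℓ n : ℕ} (r≥1 : 1 ≤ r) (T : TightTree r ℓ) where

  high-codegree⇒empty : (G : RGraph r n) → All (λ S → ℓ ≤ codeg S (edges G)) (shadow G) →
    ¬ ContainsCopy G T → length (edges G) ≡ 0
  high-codegree⇒empty G high T-free =
    no-members⇒empty (edges G) λ g∈G → T-free (high-codegree⇒copy r≥1 T G high′ g∈G)
    where
    high′ : ∀ S → InShadow r (edges G) S → ℓ ≤ codeg S (edges G)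
    high′ S S∈∂G = All.lookup high (∈-filter⁺ (inShadow? r (edges G)) (∈-allSubsets S) S∈∂G)

  tree-free-bound : (G : RGraph r n) → Acc _<_ ∣∂ G ∣ → ¬ ContainsCopy G T →
    length (edges G) ≤ (ℓ ∸ 1) * ∣∂ G ∣
  tree-free-bound G (acc smaller) T-free with All.all? (λ S → ℓ ≤? codeg S (edges G)) (shadow G)
  ... | yes high = subst (_≤ (ℓ ∸ 1) * ∣∂ G ∣) (sym (high-codegree⇒empty G high T-free)) z≤n
  ... | no ¬high with find (AllP.¬All⇒Any¬ (λ S → ℓ ≤? codeg S (edges G)) (shadow G) ¬high)
  ...   | S , S∈∂G , low = begin
    length (edges G)                          ≡⟨ size-split ⟩
    codeg S (edges G) + length (edges G′)     ≤⟨ +-mono-≤ (∸-monoˡ-≤ 1 (≰⇒> low))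
                                                   (tree-free-bound G′ (smaller shrinks) (T-free ∘ copy-in-G T)) ⟩
    (ℓ ∸ 1) + (ℓ ∸ 1) * ∣∂ G′ ∣               ≡⟨ sym (*-suc (ℓ ∸ 1) ∣∂ G′ ∣) ⟩
    (ℓ ∸ 1) * suc ∣∂ G′ ∣                     ≤⟨ *-monoʳ-≤ (ℓ ∸ 1) shrinks ⟩
    (ℓ ∸ 1) * ∣∂ G ∣                          ∎
    where
    open Deletion S G
    open ≤-Reasoning
    shrinks : ∣∂ G′ ∣ < ∣∂ G ∣
    shrinks = shadow-shrinks (proj₂ (∈-filter⁻ (inShadow? r (edges G)) {xs = allSubsets n} S∈∂G))

proposition1 : (r ℓ n : ℕ) → 1 ≤ r → (T : TightTree r ℓ) → (G : RGraph r n) →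
    ¬ ContainsCopy G T → length (edges G) ≤ (ℓ ∸ 1) * ∣∂ G ∣
proposition1 r ℓ n r≥1 T G T-free = tree-free-bound r≥1 T G (<-wellFounded ∣∂ G ∣) T-free
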